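{- Let $p$ be a prime, $n$ a non-negative integer and $k$ a positive integer. Then \[5F_{np^{2k}}\equiv 5F_{np^{2(k-1)}}\pmod{p^k}.\]
   Context: $(F_n)$ denotes the Fibonacci sequence ($F_0=0$, $F_1=F_2=1$, $F_{n+2}=F_{n+1}+F_n$). -}

module Defs where

open import Data.Nat using (ℕ; zero; suc; _+_)

fib : ℕ → ℕ
fib zero = 0
fib (suc zero) = 1
fib (suc (suc n)) = fib (suc n) + fib n

-- Work in ℤ[φ], φ² = φ + 1, where φⁿ = (F₍ₙ₊₁₎ - Fₙ) + Fₙ φ: congruences between powers
-- of φ become congruences between Fibonacci numbers. As p divides the middle binomial
-- coefficients C(p, j), every commutative semiring satisfies (x + y)ᵖ ≡ xᵖ + yᵖ (mod p), and
-- x ≡ y (mod p a) implies xᵖ ≡ yᵖ (mod p² a); iterating, x ≡ y (mod p) gives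
-- x^(m pⁱ) ≡ y^(m pⁱ) (mod pⁱ⁺¹). For p ≠ 5 the theorem thus follows from φ^(p²) ≡ φ (mod p).
-- For p = 2 this is a computation; for odd p write 2φ = 1 + θ with θ² = 5, so that
-- (2φ)^(p²) ≡ 1 + θ·5^((p²-1)/2) ≡ 1 + θ (mod p) by Frobenius and Fermat, and cancel 2.
-- For p = 5 the conjugate ψ = 1 - φ satisfies φ⁵ ≡ ψ⁵ (mod 5), whence 5ʲ ∣ F(m 5ʲ): both
-- Fibonacci numbers are divisible by 5ᵏ, and the factor 5 provides the last power of 5.

module Submission where

open import Algebra.Bundles using (CommutativeSemiring)
open import Data.Nat as ℕ using (ℕ; zero; suc)
import Data.Nat.Properties as ℕ
open import Data.Nat.Primality using (Prime)
open import Data.Product using (∃; ∃₂; _,_; proj₁; proj₂)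
open import Defs using (fib)
open import Relation.Nullary using (¬_)

module BinomialCoefficient where

  open import Data.Nat using (_+_; _*_; _<_)
  open import Data.Nat.Combinatorics using (_C_; nC1≡n; nCk+nC[k+1]≡[n+1]C[k+1])
  open import Data.Nat.Divisibility using (_∣_; divides; ∣⇒≤)
  open import Data.Nat.Primality using (euclidsLemma)
  open import Data.Nat.Tactic.RingSolver using (solve-∀)
  open import Data.Sum using (inj₁; inj₂)
  open import Relation.Binary.PropositionalEquality
  open import Relation.Nullary using (contradiction)

  [k+1]*[n+1]C[k+1]≡[n+1]*nCk : ∀ n k → suc k * (suc n C suc k) ≡ suc n * (n C k)
  [k+1]*[n+1]C[k+1]≡[n+1]*nCk n zero = begin
    1 * (suc n C 1) ≡⟨ ℕ.*-identityˡ _ ⟩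
    suc n C 1       ≡⟨ nC1≡n (suc n) ⟩
    suc n           ≡⟨ ℕ.*-identityʳ (suc n) ⟨
    suc n * 1       ∎
    where open ≡-Reasoning
  [k+1]*[n+1]C[k+1]≡[n+1]*nCk zero (suc k) = ℕ.*-zeroʳ (suc (suc k))
  [k+1]*[n+1]C[k+1]≡[n+1]*nCk (suc n) (suc k) = begin
    suc (suc k) * (suc (suc n) C suc (suc k))   ≡⟨ cong (suc (suc k) *_) (pascal (suc n) (suc k)) ⟨
    suc (suc k) * (A + B)                       ≡⟨ distrib k A B ⟩
    A + suc k * A + suc (suc k) * B             ≡⟨ cong₂ (λ u v → A + u + v)
                                                     ([k+1]*[n+1]C[k+1]≡[n+1]*nCk n k)
                                                     ([k+1]*[n+1]C[k+1]≡[n+1]*nCk n (suc k)) ⟩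
    A + suc n * (n C k) + suc n * (n C suc k)   ≡⟨ ℕ.+-assoc A _ _ ⟩
    A + (suc n * (n C k) + suc n * (n C suc k)) ≡⟨ cong (A +_) (ℕ.*-distribˡ-+ (suc n) (n C k) (n C suc k)) ⟨
    A + suc n * (n C k + n C suc k)             ≡⟨ cong (λ v → A + suc n * v) (pascal n k) ⟩
    suc (suc n) * A                             ∎
    where
    open ≡-Reasoning
    pascal : ∀ n k → n C k + n C suc k ≡ suc n C suc k
    pascal = nCk+nC[k+1]≡[n+1]C[k+1]
    A B : ℕ
    A = suc n C suc k
    B = suc n C suc (suc k)
    distrib : ∀ k A B → suc (suc k) * (A + B) ≡ A + suc k * A + suc (suc k) * B
    distrib = solve-∀

  p∣pC[k+1] : ∀ {p k} → Prime p → suc k < p → p ∣ p C suc k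
  p∣pC[k+1] {suc n} {k} prime-p k+1<p
    with euclidsLemma (suc k) (suc n C suc k) prime-p
           (divides (n C k) (trans ([k+1]*[n+1]C[k+1]≡[n+1]*nCk n k) (ℕ.*-comm (suc n) (n C k))))
  ... | inj₁ p∣k+1 = contradiction (∣⇒≤ p∣k+1) (ℕ.<⇒≱ k+1<p)
  ... | inj₂ p∣C   = p∣C

open BinomialCoefficient using (p∣pC[k+1])

module ModularInverse where

  open import Data.Nat using (_+_; _*_)
  open import Data.Nat.Coprimality using (Coprime; coprime-Bézout)
  open import Data.Nat.Divisibility using (_∣_)
  open import Data.Nat.GCD using (module Bézout)
  open import Data.Nat.Primality using (prime⇒irreducible)
  open import Data.Nat.Tactic.RingSolver using (solve-∀)
  open import Data.Sum using ([_,_])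
  open import Function using (id)
  open import Relation.Binary.PropositionalEquality using (_≡_; subst; cong; module ≡-Reasoning)
  open import Relation.Nullary using (contradiction)

  prime∤⇒coprime : ∀ {p n} → Prime p → ¬ p ∣ n → Coprime n p
  prime∤⇒coprime prime-p p∤n (d∣n , d∣p) =
    [ id , (λ d≡p → contradiction (subst (_∣ _) d≡p d∣n) p∤n) ] (prime⇒irreducible prime-p d∣p)

  prime∤⇒invertible : ∀ {p n} → Prime p → ¬ p ∣ n → ∃₂ λ u s → ∃ λ t → u * n + p * s ≡ 1 + p * t
  prime∤⇒invertible {suc q} {n} prime-p p∤n with coprime-Bézout (prime∤⇒coprime prime-p p∤n)
  ... | Bézout.+- x y 1+yp≡xn = x , 0 , y , (begin
    x * n + suc q * 0 ≡⟨ cong (x * n +_) (ℕ.*-zeroʳ (suc q)) ⟩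
    x * n + 0         ≡⟨ ℕ.+-identityʳ (x * n) ⟩
    x * n             ≡⟨ 1+yp≡xn ⟨
    1 + y * suc q     ≡⟨ cong (1 +_) (ℕ.*-comm y (suc q)) ⟩
    1 + suc q * y     ∎)
    where open ≡-Reasoning
  ... | Bézout.-+ x y 1+xn≡yp = q * x , 1 , q * y , (begin
    q * x * n + suc q * 1 ≡⟨ expand q x n ⟩
    1 + q * (1 + x * n)   ≡⟨ cong (λ v → 1 + q * v) 1+xn≡yp ⟩
    1 + q * (y * suc q)   ≡⟨ regroup q y ⟩
    1 + suc q * (q * y)   ∎)
    where
    open ≡-Reasoning
    expand : ∀ q x n → q * x * n + suc q * 1 ≡ 1 + q * (1 + x * n)
    expand = solve-∀
    regroup : ∀ q y → 1 + q * (y * suc q) ≡ 1 + suc q * (q * y)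
    regroup = solve-∀

open ModularInverse using (prime∤⇒invertible)

module OddPrimes where

  open import Data.Nat using (_*_)
  open import Data.Nat.Divisibility using (_∣_; divides)
  open import Data.Nat.Primality using (prime[2]; prime⇒irreducible; ¬prime[1])
  open import Data.Sum using (_⊎_; inj₁; inj₂)
  open import Relation.Binary.PropositionalEquality using (_≡_; _≢_; refl; cong; trans; sym)
  open import Relation.Nullary using (contradiction)

  even⊎odd : ∀ n → ∃ λ h → n ≡ 2 * h ⊎ n ≡ suc (2 * h)
  even⊎odd zero = 0 , inj₁ refl
  even⊎odd (suc n) with even⊎odd n
  ... | h , inj₁ n≡2h   = h , inj₂ (cong suc n≡2h)
  ... | h , inj₂ n≡1+2h = suc h , inj₁ (trans (cong suc n≡1+2h) (sym (ℕ.*-suc 2 h)))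

  prime∣prime⇒≡ : ∀ {p q} → Prime p → Prime q → p ∣ q → p ≡ q
  prime∣prime⇒≡ prime-p prime-q p∣q with prime⇒irreducible prime-q p∣q
  ... | inj₁ refl = contradiction prime-p ¬prime[1]
  ... | inj₂ p≡q  = p≡q

  prime≢2⇒odd : ∀ {p} → Prime p → p ≢ 2 → ∃ λ h → p ≡ suc (2 * h)
  prime≢2⇒odd {p} prime-p p≢2 with even⊎odd p
  ... | h , inj₂ p≡1+2h = h , p≡1+2h
  ... | h , inj₁ p≡2h   = contradiction (sym (prime∣prime⇒≡ prime[2] prime-p 2∣p)) p≢2
    where
    2∣p : 2 ∣ p
    2∣p = divides h (trans p≡2h (ℕ.*-comm 2 h))

open OddPrimes using (prime∣prime⇒≡; prime≢2⇒odd)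

module Congruence {c ℓ} (S : CommutativeSemiring c ℓ) where

  open CommutativeSemiring S hiding (zero)
  open import Data.Fin using (Fin; zero; suc; toℕ; fromℕ; inject₁)
  open import Data.Fin.Properties using (toℕ-fromℕ; toℕ-inject₁; toℕ<n)
  open import Data.Nat using (_<_; s<s)
  open import Data.Nat.Combinatorics using (_C_; nCn≡1)
  open import Data.Nat.Divisibility as ℕ∣ using (divides)
  open import Data.Nat.Primality using (prime⇒nonZero)
  open import Level using (_⊔_)
  open import Algebra.Properties.Semiring.Exp semiring using (_^_; ^-congˡ; ^-congʳ; ^-assocʳ)
  open import Algebra.Properties.Semiring.Mult semiring
    using (_×_; ×-congʳ; ×-homo-1; ×-homo-+; ×-assocˡ; ×-comm-*; ×-assoc-*; ×1-homo-*)
  open import Algebra.Properties.Semiring.Sum semiring using (sum; sum-cong-≋; sum-init-last; *-distribˡ-sum)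
  open import Algebra.Properties.CommutativeSemiring.Binomial S using (theorem; binomialTerm)
  open import Algebra.Properties.CommutativeSemiring.Exp S using (^-distrib-*)
  open import Relation.Binary.PropositionalEquality as ≡ using (_≡_)
  open import Algebra.Solver.Ring.NaturalCoefficients.Default S
  open import Relation.Binary.Bundles using (Setoid)
  import Relation.Binary.Reasoning.Setoid as SetoidReasoning
  module ≈-Reasoning = SetoidReasoning setoid

  -- x ≡ y mod a says that x - y lies in the ideal a S, phrased without subtraction.
  infix 4 _≡_mod_
  _≡_mod_ : Carrier → Carrier → Carrier → Set (c ⊔ ℓ)
  x ≡ y mod a = ∃₂ λ u v → x + a * u ≈ y + a * v

  module _ {a : Carrier} where

    ≈⇒≡-mod : ∀ {x y} → x ≈ y → x ≡ y mod a
    ≈⇒≡-mod x≈y = 0# , 0# , +-congʳ x≈y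

    ≡-mod-refl : ∀ {x} → x ≡ x mod a
    ≡-mod-refl = ≈⇒≡-mod refl

    ≡-mod-sym : ∀ {x y} → x ≡ y mod a → y ≡ x mod a
    ≡-mod-sym (u , v , eq) = v , u , sym eq

    ≡-mod-trans : ∀ {x y z} → x ≡ y mod a → y ≡ z mod a → x ≡ z mod a
    ≡-mod-trans {x} {y} {z} (u , v , x≈y) (u′ , v′ , y≈z) = u + u′ , v′ + v , (begin
      x + a * (u + u′)    ≈⟨ shift x u u′ ⟩
      (x + a * u) + a * u′ ≈⟨ +-congʳ x≈y ⟩
      (y + a * v) + a * u′ ≈⟨ swap y v u′ ⟩
      (y + a * u′) + a * v ≈⟨ +-congʳ y≈z ⟩
      (z + a * v′) + a * v ≈⟨ shift z v′ v ⟨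
      z + a * (v′ + v)    ∎)
      where
      open ≈-Reasoning
      shift : ∀ s t r → s + a * (t + r) ≈ (s + a * t) + a * r
      shift = solve 4 (λ a s t r → s :+ a :* (t :+ r) := (s :+ a :* t) :+ a :* r) refl a
      swap : ∀ s t r → (s + a * t) + a * r ≈ (s + a * r) + a * t
      swap = solve 4 (λ a s t r → (s :+ a :* t) :+ a :* r := (s :+ a :* r) :+ a :* t) refl a

    ≡-mod-setoid : Setoid c (c ⊔ ℓ)
    ≡-mod-setoid = record
      { Carrier = Carrier
      ; _≈_ = _≡_mod a
      ; isEquivalence = record { refl = ≡-mod-refl ; sym = ≡-mod-sym ; trans = ≡-mod-trans }
      }

    ≡-mod-resp : ∀ {b x y} → a ≈ b → x ≡ y mod a → x ≡ y mod b
    ≡-mod-resp a≈b (u , v , eq) = u , v , trans (+-congˡ (*-congʳ (sym a≈b))) (trans eq (+-congˡ (*-congʳ a≈b)))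

    x+az≡x : ∀ x z → x + a * z ≡ x mod a
    x+az≡x x z = 0# , z , solve 3 (λ a x z → (x :+ a :* z) :+ a :* con 0 := x :+ a :* z) refl a x z

    +-cong-mod : ∀ {x x′ y y′} → x ≡ x′ mod a → y ≡ y′ mod a → x + y ≡ x′ + y′ mod a
    +-cong-mod {x} {x′} {y} {y′} (u , u′ , x≈x′) (v , v′ , y≈y′) = u + v , u′ + v′ , (begin
      (x + y) + a * (u + v)         ≈⟨ regroup x y u v ⟩
      (x + a * u) + (y + a * v)     ≈⟨ +-cong x≈x′ y≈y′ ⟩
      (x′ + a * u′) + (y′ + a * v′) ≈⟨ regroup x′ y′ u′ v′ ⟨
      (x′ + y′) + a * (u′ + v′)     ∎)
      where
      open ≈-Reasoning
      regroup : ∀ x y u v → (x + y) + a * (u + v) ≈ (x + a * u) + (y + a * v)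
      regroup = solve 5 (λ a x y u v → (x :+ y) :+ a :* (u :+ v) := (x :+ a :* u) :+ (y :+ a :* v)) refl a

    *-cong-mod : ∀ {x x′ y y′} → x ≡ x′ mod a → y ≡ y′ mod a → x * y ≡ x′ * y′ mod a
    *-cong-mod {x} {x′} {y} {y′} (u , u′ , x≈x′) (v , v′ , y≈y′) =
      u * y + x * v + a * u * v , u′ * y′ + x′ * v′ + a * u′ * v′ , (begin
      x * y + a * (u * y + x * v + a * u * v)          ≈⟨ expand x y u v ⟨
      (x + a * u) * (y + a * v)                        ≈⟨ *-cong x≈x′ y≈y′ ⟩
      (x′ + a * u′) * (y′ + a * v′)                    ≈⟨ expand x′ y′ u′ v′ ⟩
      x′ * y′ + a * (u′ * y′ + x′ * v′ + a * u′ * v′) ∎)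
      where
      open ≈-Reasoning
      expand : ∀ x y u v → (x + a * u) * (y + a * v) ≈ x * y + a * (u * y + x * v + a * u * v)
      expand = solve 5 (λ a x y u v → (x :+ a :* u) :* (y :+ a :* v)
                                    := x :* y :+ a :* (u :* y :+ x :* v :+ a :* u :* v)) refl a

    ^-cong-mod : ∀ {x y} n → x ≡ y mod a → x ^ n ≡ y ^ n mod a
    ^-cong-mod zero    x≡y = ≡-mod-refl
    ^-cong-mod (suc n) x≡y = *-cong-mod x≡y (^-cong-mod n x≡y)

    *-cancelˡ-mod : ∀ {u c x y} → u * c ≡ 1# mod a → c * x ≡ c * y mod a → x ≡ y mod a
    *-cancelˡ-mod {u} {c} {x} {y} uc≡1 cx≡cy = begin
      x           ≈⟨ ≈⇒≡-mod (*-identityˡ x) ⟨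
      1# * x      ≈⟨ *-cong-mod uc≡1 ≡-mod-refl ⟨
      u * c * x   ≈⟨ ≈⇒≡-mod (*-assoc u c x) ⟩
      u * (c * x) ≈⟨ *-cong-mod ≡-mod-refl cx≡cy ⟩
      u * (c * y) ≈⟨ ≈⇒≡-mod (*-assoc u c y) ⟨
      u * c * y   ≈⟨ *-cong-mod uc≡1 ≡-mod-refl ⟩
      1# * y      ≈⟨ ≈⇒≡-mod (*-identityˡ y) ⟩
      y           ∎
      where open SetoidReasoning ≡-mod-setoid

  ×≈×1* : ∀ n x → n × x ≈ n × 1# * x
  ×≈×1* n x = begin
    n × x        ≈⟨ ×-congʳ n (*-identityˡ x) ⟨
    n × (1# * x) ≈⟨ ×-assoc-* n 1# x ⟨
    n × 1# * x   ∎
    where open ≈-Reasoning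

  first-binomialTerm : ∀ n x y → binomialTerm x y n zero ≈ y ^ n
  first-binomialTerm n x y = trans (×-homo-1 _) (*-identityˡ _)

  last-binomialTerm : ∀ n x y → binomialTerm x y n (fromℕ n) ≈ x ^ n
  last-binomialTerm n x y rewrite toℕ-fromℕ n | nCn≡1 n | ℕ.n∸n≡0 n =
    trans (×-homo-1 _) (*-identityʳ _)

  binomialTerm-multiple : ∀ {n k d} → d ℕ∣.∣ n C suc k → ∀ x z →
                          ∃ λ w → (n C suc k) × (x ^ suc k * z) ≈ d × 1# * x * w
  binomialTerm-multiple {n} {k} {d} (divides q C≡qd) x z = q × (x ^ k * z) , (begin
    (n C suc k) × (x * x ^ k * z)    ≡⟨ ≡.cong (_× _) (≡.trans C≡qd (ℕ.*-comm q d)) ⟩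
    (d ℕ.* q) × (x * x ^ k * z)      ≈⟨ ×-assocˡ _ d q ⟨
    d × (q × (x * x ^ k * z))        ≈⟨ ×-congʳ d (×-congʳ q (*-assoc x _ z)) ⟩
    d × (q × (x * (x ^ k * z)))      ≈⟨ ×-congʳ d (×-comm-* q x _) ⟨
    d × (x * (q × (x ^ k * z)))      ≈⟨ ×≈×1* d _ ⟩
    d × 1# * (x * (q × (x ^ k * z))) ≈⟨ *-assoc _ x _ ⟨
    d × 1# * x * (q × (x ^ k * z))   ∎)
    where open ≈-Reasoning

  binomial-divisible-middle : ∀ m d x y → (∀ j → suc j < suc m → d ℕ∣.∣ suc m C suc j) →
                              ∃ λ w → (x + y) ^ suc m ≈ x ^ suc m + y ^ suc m + d × 1# * x * w
  binomial-divisible-middle m d x y d∣C = sum w , (begin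
    (x + y) ^ n                                             ≈⟨ theorem n x y ⟩
    T zero + sum (λ i → T (suc i))                          ≈⟨ +-congˡ (sum-init-last (λ i → T (suc i))) ⟩
    T zero + (sum (λ i → T (suc (inject₁ i))) + T (fromℕ n)) ≈⟨ +-cong (first-binomialTerm n x y)
                                                                  (+-cong (sum-cong-≋ middle) (last-binomialTerm n x y)) ⟩
    y ^ n + (sum (λ i → D * x * w i) + x ^ n)               ≈⟨ +-congˡ (+-congʳ (*-distribˡ-sum (D * x) w)) ⟨
    y ^ n + (D * x * sum w + x ^ n)                         ≈⟨ rotate (y ^ n) (D * x * sum w) (x ^ n) ⟩
    x ^ n + y ^ n + D * x * sum w                           ∎)
    where
    open ≈-Reasoning
    n : ℕ
    n = suc m
    D : Carrier
    D = d × 1#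
    T : Fin (suc n) → Carrier
    T = binomialTerm x y n
    middle-multiple : (i : Fin m) → ∃ λ w → T (suc (inject₁ i)) ≈ D * x * w
    middle-multiple i = binomialTerm-multiple {n} {j} (d∣C j (s<s j<m)) x _
      where
      j : ℕ
      j = toℕ (inject₁ i)
      j<m : j < m
      j<m = ≡.subst (_< m) (≡.sym (toℕ-inject₁ i)) (toℕ<n i)
    w : Fin m → Carrier
    w i = proj₁ (middle-multiple i)
    middle : ∀ i → T (suc (inject₁ i)) ≈ D * x * w i
    middle i = proj₂ (middle-multiple i)
    rotate : ∀ a b c → a + (b + c) ≈ c + a + b
    rotate = solve 3 (λ a b c → a :+ (b :+ c) := c :+ a :+ b) refl

  x^[1+2r]≈x*[xx]^r : ∀ x r → x ^ suc (2 ℕ.* r) ≈ x * (x * x) ^ r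
  x^[1+2r]≈x*[xx]^r x r = *-congˡ (trans (sym (^-assocʳ x 2 r)) (^-congˡ r (*-congˡ (*-identityʳ x))))

  ×1-homo-^ : ∀ m i → (m × 1#) ^ i ≈ (m ℕ.^ i) × 1#
  ×1-homo-^ m zero    = sym (×-homo-1 1#)
  ×1-homo-^ m (suc i) = trans (*-congˡ (×1-homo-^ m i)) (sym (×1-homo-* m (m ℕ.^ i)))

  1#^n≈1# : ∀ n → 1# ^ n ≈ 1#
  1#^n≈1# zero    = refl
  1#^n≈1# (suc n) = trans (*-identityˡ _) (1#^n≈1# n)

  ×1-cong-mod : ∀ {m a b s t} → a ℕ.+ m ℕ.* s ≡ b ℕ.+ m ℕ.* t → a × 1# ≡ b × 1# mod m × 1#
  ×1-cong-mod {m} {a} {b} {s} {t} eq = s × 1# , t × 1# , (begin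
    a × 1# + m × 1# * s × 1#  ≈⟨ +-congˡ (×1-homo-* m s) ⟨
    a × 1# + (m ℕ.* s) × 1#   ≈⟨ ×-homo-+ 1# a (m ℕ.* s) ⟨
    (a ℕ.+ m ℕ.* s) × 1#      ≡⟨ ≡.cong (_× 1#) eq ⟩
    (b ℕ.+ m ℕ.* t) × 1#      ≈⟨ ×-homo-+ 1# b (m ℕ.* t) ⟩
    b × 1# + (m ℕ.* t) × 1#   ≈⟨ +-congˡ (×1-homo-* m t) ⟩
    b × 1# + m × 1# * t × 1#  ∎)
    where open ≈-Reasoning

  prime-binomial : ∀ {p} → Prime p → ∀ x y → ∃ λ w → (x + y) ^ p ≈ x ^ p + y ^ p + p × 1# * x * w
  prime-binomial {suc m} prime-p x y = binomial-divisible-middle m (suc m) x y (λ _ → p∣pC[k+1] prime-p)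

  -- With X = p a e, the middle binomial terms of (X + z)ᵖ are multiples of p X, and since p ≥ 2
  -- so is Xᵖ = X (X Xᵖ⁻²); all of them are multiples of p (p a).
  ^p-absorb : ∀ {p} → Prime p → ∀ a z e → (z + p × 1# * a * e) ^ p ≡ z ^ p mod p × 1# * (p × 1# * a)
  ^p-absorb {suc (suc m)} prime-p a z e = ≡-mod-trans (≈⇒≡-mod (begin
    (z + X) ^ p                          ≈⟨ ^-congˡ p (+-comm z X) ⟩
    (X + z) ^ p                          ≈⟨ proj₂ (prime-binomial prime-p X z) ⟩
    X * (X * X ^ m) + z ^ p + P * X * w  ≈⟨ regroup P a e (X ^ m) (z ^ p) w ⟩
    z ^ p + P * (P * a) * (a * e * e * X ^ m + e * w) ∎)) (x+az≡x _ _)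
    where
    open ≈-Reasoning
    p : ℕ
    p = suc (suc m)
    P X w : Carrier
    P = p × 1#
    X = P * a * e
    w = proj₁ (prime-binomial prime-p X z)
    regroup : ∀ P a e r zp w → (P * a * e) * ((P * a * e) * r) + zp + P * (P * a * e) * w
                                ≈ zp + P * (P * a) * (a * e * e * r + e * w)
    regroup = solve 6 (λ P a e r zp w → (P :* a :* e) :* ((P :* a :* e) :* r) :+ zp :+ P :* (P :* a :* e) :* w
                                        := zp :+ P :* (P :* a) :* (a :* e :* e :* r :+ e :* w)) refl

  ^p-lift : ∀ {p a x y} → Prime p → x ≡ y mod p × 1# * a → x ^ p ≡ y ^ p mod p × 1# * (p × 1# * a)
  ^p-lift {p} {a} {x} {y} prime-p (u , v , x+au≈y+av) = begin
    x ^ p                   ≈⟨ ^p-absorb prime-p a x u ⟨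
    (x + p × 1# * a * u) ^ p ≈⟨ ≈⇒≡-mod (^-congˡ p x+au≈y+av) ⟩
    (y + p × 1# * a * v) ^ p ≈⟨ ^p-absorb prime-p a y v ⟩
    y ^ p                   ∎
    where open SetoidReasoning ≡-mod-setoid

  module _ {p} (prime-p : Prime p) where

    private
      1+pred[p]≡p : suc (ℕ.pred p) ≡ p
      1+pred[p]≡p = ℕ.suc-pred p {{prime⇒nonZero prime-p}}

    frobenius : ∀ x y → (x + y) ^ p ≡ x ^ p + y ^ p mod p × 1#
    frobenius x y with prime-binomial prime-p x y
    ... | w , eq = ≡-mod-trans (≈⇒≡-mod (trans eq (+-congˡ (*-assoc _ x w)))) (x+az≡x _ _)

    ^[p^i]-lift : ∀ i {x y} → x ≡ y mod p × 1# → x ^ (p ℕ.^ i) ≡ y ^ (p ℕ.^ i) mod (p × 1#) ^ suc i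
    ^[p^i]-lift zero    x≡y = ≡-mod-resp (sym (*-identityʳ _)) (*-cong-mod x≡y ≡-mod-refl)
    ^[p^i]-lift (suc i) {x} {y} x≡y = begin
      x ^ (p ℕ.^ suc i)   ≈⟨ ≈⇒≡-mod (^[p^[1+i]]≈[^[p^i]]^p x) ⟩
      (x ^ (p ℕ.^ i)) ^ p ≈⟨ ^p-lift prime-p (^[p^i]-lift i x≡y) ⟩
      (y ^ (p ℕ.^ i)) ^ p ≈⟨ ≈⇒≡-mod (^[p^[1+i]]≈[^[p^i]]^p y) ⟨
      y ^ (p ℕ.^ suc i)   ∎
      where
      open SetoidReasoning ≡-mod-setoid
      ^[p^[1+i]]≈[^[p^i]]^p : ∀ z → z ^ (p ℕ.^ suc i) ≈ (z ^ (p ℕ.^ i)) ^ p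
      ^[p^[1+i]]≈[^[p^i]]^p z = trans (^-congʳ z (ℕ.*-comm p (p ℕ.^ i))) (sym (^-assocʳ z (p ℕ.^ i) p))

    ^[m*p^i]-lift : ∀ m i {x y} → x ≡ y mod p × 1# →
                    x ^ (m ℕ.* p ℕ.^ i) ≡ y ^ (m ℕ.* p ℕ.^ i) mod (p ℕ.^ suc i) × 1#
    ^[m*p^i]-lift m i {x} {y} x≡y = ≡-mod-resp (×1-homo-^ p (suc i)) (begin
      x ^ (m ℕ.* p ℕ.^ i)   ≈⟨ ≈⇒≡-mod (^-assocʳ x m (p ℕ.^ i)) ⟨
      (x ^ m) ^ (p ℕ.^ i)   ≈⟨ ^[p^i]-lift i (^-cong-mod m x≡y) ⟩
      (y ^ m) ^ (p ℕ.^ i)   ≈⟨ ≈⇒≡-mod (^-assocʳ y m (p ℕ.^ i)) ⟩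
      y ^ (m ℕ.* p ℕ.^ i)   ∎)
      where open SetoidReasoning ≡-mod-setoid

    fermat : ∀ n → (n × 1#) ^ p ≡ n × 1# mod p × 1#
    fermat zero    = ≈⇒≡-mod (trans (^-congʳ 0# (≡.sym 1+pred[p]≡p)) (zeroˡ _))
    fermat (suc n) = begin
      (1# + n × 1#) ^ p     ≈⟨ frobenius 1# (n × 1#) ⟩
      1# ^ p + (n × 1#) ^ p ≈⟨ +-cong-mod (≈⇒≡-mod (1#^n≈1# p)) (fermat n) ⟩
      1# + n × 1#           ∎
      where open SetoidReasoning ≡-mod-setoid

    ×1-invertible : ∀ {n} → ¬ p ℕ∣.∣ n → ∃ λ u → u * n × 1# ≡ 1# mod p × 1#
    ×1-invertible {n} p∤n with prime∤⇒invertible prime-p p∤n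
    ... | u , s , t , un+ps≡1+pt = u × 1# , (begin
      u × 1# * n × 1#   ≈⟨ ≈⇒≡-mod (×1-homo-* u n) ⟨
      (u ℕ.* n) × 1#    ≈⟨ ×1-cong-mod {p} {u ℕ.* n} {1} un+ps≡1+pt ⟩
      1 × 1#            ≈⟨ ≈⇒≡-mod (×-homo-1 1#) ⟩
      1#                ∎)
      where open SetoidReasoning ≡-mod-setoid

    fermat-little : ∀ {n} → ¬ p ℕ∣.∣ n → (n × 1#) ^ ℕ.pred p ≡ 1# mod p × 1#
    fermat-little {n} p∤n = *-cancelˡ-mod (proj₂ (×1-invertible p∤n)) (begin
      n × 1# * (n × 1#) ^ ℕ.pred p ≈⟨ ≈⇒≡-mod (^-congʳ (n × 1#) 1+pred[p]≡p) ⟩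
      (n × 1#) ^ p                 ≈⟨ fermat n ⟩
      n × 1#                       ≈⟨ ≈⇒≡-mod (*-identityʳ _) ⟨
      n × 1# * 1#                  ∎)
      where open SetoidReasoning ≡-mod-setoid

    ^[p*p]≈^p^p : ∀ x → x ^ (p ℕ.* p) ≈ (x ^ p) ^ p
    ^[p*p]≈^p^p x = sym (^-assocʳ x p p)

    frobenius² : ∀ x y → (x + y) ^ (p ℕ.* p) ≡ x ^ (p ℕ.* p) + y ^ (p ℕ.* p) mod p × 1#
    frobenius² x y = begin
      (x + y) ^ (p ℕ.* p)             ≈⟨ ≈⇒≡-mod (^[p*p]≈^p^p (x + y)) ⟩
      ((x + y) ^ p) ^ p               ≈⟨ ^-cong-mod p (frobenius x y) ⟩
      (x ^ p + y ^ p) ^ p             ≈⟨ frobenius (x ^ p) (y ^ p) ⟩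
      (x ^ p) ^ p + (y ^ p) ^ p       ≈⟨ ≈⇒≡-mod (+-cong (^[p*p]≈^p^p x) (^[p*p]≈^p^p y)) ⟨
      x ^ (p ℕ.* p) + y ^ (p ℕ.* p)   ∎
      where open SetoidReasoning ≡-mod-setoid

    fermat² : ∀ n → (n × 1#) ^ (p ℕ.* p) ≡ n × 1# mod p × 1#
    fermat² n = begin
      (n × 1#) ^ (p ℕ.* p) ≈⟨ ≈⇒≡-mod (^[p*p]≈^p^p (n × 1#)) ⟩
      ((n × 1#) ^ p) ^ p   ≈⟨ ^-cong-mod p (fermat n) ⟩
      (n × 1#) ^ p         ≈⟨ fermat n ⟩
      n × 1#               ∎
      where open SetoidReasoning ≡-mod-setoid

  φ^[p*p]≡φ-odd : ∀ {p q φ θ} → Prime p → p ≡ suc (2 ℕ.* q) → ¬ p ℕ∣.∣ 2 → ¬ p ℕ∣.∣ 5 →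
                  θ * θ ≈ 5 × 1# → 2 × 1# * φ ≈ 1# + θ → φ ^ (p ℕ.* p) ≡ φ mod p × 1#
  φ^[p*p]≡φ-odd {q = q} {φ} {θ} prime-p ≡.refl p∤2 p∤5 θ²≈5 2φ≈1+θ =
    *-cancelˡ-mod (proj₂ (×1-invertible prime-p p∤2)) (begin
      2 × 1# * φ ^ pp            ≈⟨ *-cong-mod (fermat² prime-p 2) ≡-mod-refl ⟨
      (2 × 1#) ^ pp * φ ^ pp     ≈⟨ ≈⇒≡-mod (^-distrib-* (2 × 1#) φ pp) ⟨
      (2 × 1# * φ) ^ pp          ≈⟨ ≈⇒≡-mod (^-congˡ pp 2φ≈1+θ) ⟩
      (1# + θ) ^ pp              ≈⟨ frobenius² prime-p 1# θ ⟩
      1# ^ pp + θ ^ pp           ≈⟨ ≈⇒≡-mod (+-cong (1#^n≈1# pp) θ^pp≈θ*5^r) ⟩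
      1# + θ * (5 × 1#) ^ r      ≈⟨ +-cong-mod ≡-mod-refl (*-cong-mod ≡-mod-refl 5^r≡1) ⟩
      1# + θ * 1#                ≈⟨ ≈⇒≡-mod (trans (+-congˡ (*-identityʳ θ)) (sym 2φ≈1+θ)) ⟩
      2 × 1# * φ                 ∎)
    where
    open SetoidReasoning ≡-mod-setoid
    p pp r : ℕ
    p = suc (2 ℕ.* q)
    pp = p ℕ.* p
    r = 2 ℕ.* q ℕ.* suc q
    pp≡1+2r : pp ≡ suc (2 ℕ.* r)
    pp≡1+2r = square q
      where
      open import Data.Nat.Tactic.RingSolver using (solve-∀)
      square : ∀ q → suc (2 ℕ.* q) ℕ.* suc (2 ℕ.* q) ≡ suc (2 ℕ.* (2 ℕ.* q ℕ.* suc q))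
      square = solve-∀
    θ^pp≈θ*5^r : θ ^ pp ≈ θ * (5 × 1#) ^ r
    θ^pp≈θ*5^r = trans (^-congʳ θ pp≡1+2r) (trans (x^[1+2r]≈x*[xx]^r θ r) (*-congˡ (^-congˡ r θ²≈5)))
    5^r≡1 : (5 × 1#) ^ r ≡ 1# mod p × 1#
    5^r≡1 = begin
      (5 × 1#) ^ r                    ≈⟨ ≈⇒≡-mod (^-assocʳ (5 × 1#) (2 ℕ.* q) (suc q)) ⟨
      ((5 × 1#) ^ (2 ℕ.* q)) ^ suc q  ≈⟨ ^-cong-mod (suc q) (fermat-little prime-p p∤5) ⟩
      1# ^ suc q                      ≈⟨ ≈⇒≡-mod (1#^n≈1# (suc q)) ⟩
      1#                              ∎

module GoldenIntegers where

  open import Level using (0ℓ)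
  open import Algebra.Structures.Biased using (isCommutativeSemiringˡ; isCommutativeMonoidˡ)
  open import Data.Integer using (ℤ; +_; -_; _+_; _*_; _-_; 0ℤ; 1ℤ)
  open import Data.Integer.Properties using (+-assoc; +-comm; +-identityˡ; pos-+)
  open import Data.Integer.Tactic.RingSolver using (solve-∀)
  open import Data.Integer.Divisibility.Signed using (_∣_; divides)
  open import Relation.Binary.PropositionalEquality as ≡ using (_≡_; refl; cong; cong₂; isEquivalence)

  -- [ a , b ] represents a + b φ, where φ² = φ + 1.
  record ℤ[φ] : Set where
    constructor [_,_]
    field
      c₀ c₁ : ℤ

  open ℤ[φ] public

  open import Algebra.Definitions {A = ℤ[φ]} _≡_
  open import Algebra.Structures {A = ℤ[φ]} _≡_ using (IsSemigroup)

  infixl 6 _⊕_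
  infixl 7 _⊗_

  _⊕_ : ℤ[φ] → ℤ[φ] → ℤ[φ]
  [ a , b ] ⊕ [ c , d ] = [ a + c , b + d ]

  _⊗_ : ℤ[φ] → ℤ[φ] → ℤ[φ]
  [ a , b ] ⊗ [ c , d ] = [ a * c + b * d , a * d + b * c + b * d ]

  ⊕-assoc : Associative _⊕_
  ⊕-assoc [ a , b ] [ c , d ] [ e , f ] = cong₂ [_,_] (+-assoc a c e) (+-assoc b d f)

  ⊕-comm : Commutative _⊕_
  ⊕-comm [ a , b ] [ c , d ] = cong₂ [_,_] (+-comm a c) (+-comm b d)

  ⊕-identityˡ : LeftIdentity [ 0ℤ , 0ℤ ] _⊕_
  ⊕-identityˡ [ a , b ] = cong₂ [_,_] (+-identityˡ a) (+-identityˡ b)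

  ⊗-assoc : Associative _⊗_
  ⊗-assoc [ a , b ] [ c , d ] [ e , f ] = cong₂ [_,_] (c₀-assoc a b c d e f) (c₁-assoc a b c d e f)
    where
    c₀-assoc : ∀ a b c d e f → (a * c + b * d) * e + (a * d + b * c + b * d) * f
                               ≡ a * (c * e + d * f) + b * (c * f + d * e + d * f)
    c₀-assoc = solve-∀
    c₁-assoc : ∀ a b c d e f → (a * c + b * d) * f + (a * d + b * c + b * d) * e + (a * d + b * c + b * d) * f
                               ≡ a * (c * f + d * e + d * f) + b * (c * e + d * f) + b * (c * f + d * e + d * f)
    c₁-assoc = solve-∀

  ⊗-comm : Commutative _⊗_
  ⊗-comm [ a , b ] [ c , d ] = cong₂ [_,_] (c₀-comm a b c d) (c₁-comm a b c d)
    where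
    c₀-comm : ∀ a b c d → a * c + b * d ≡ c * a + d * b
    c₀-comm = solve-∀
    c₁-comm : ∀ a b c d → a * d + b * c + b * d ≡ c * b + d * a + d * b
    c₁-comm = solve-∀

  ⊗-identityˡ : LeftIdentity [ 1ℤ , 0ℤ ] _⊗_
  ⊗-identityˡ [ a , b ] = cong₂ [_,_] (c₀-identity a b) (c₁-identity a b)
    where
    c₀-identity : ∀ a b → 1ℤ * a + 0ℤ * b ≡ a
    c₀-identity = solve-∀
    c₁-identity : ∀ a b → 1ℤ * b + 0ℤ * a + 0ℤ * b ≡ b
    c₁-identity = solve-∀

  ⊗-zeroˡ : LeftZero [ 0ℤ , 0ℤ ] _⊗_
  ⊗-zeroˡ [ a , b ] = cong₂ [_,_] (c₀-zero a b) (c₁-zero a b)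
    where
    c₀-zero : ∀ a b → 0ℤ * a + 0ℤ * b ≡ 0ℤ
    c₀-zero = solve-∀
    c₁-zero : ∀ a b → 0ℤ * b + 0ℤ * a + 0ℤ * b ≡ 0ℤ
    c₁-zero = solve-∀

  ⊗-distribʳ-⊕ : _⊗_ DistributesOverʳ _⊕_
  ⊗-distribʳ-⊕ [ a , b ] [ c , d ] [ e , f ] = cong₂ [_,_] (c₀-distrib a b c d e f) (c₁-distrib a b c d e f)
    where
    c₀-distrib : ∀ a b c d e f → (c + e) * a + (d + f) * b ≡ (c * a + d * b) + (e * a + f * b)
    c₀-distrib = solve-∀
    c₁-distrib : ∀ a b c d e f → (c + e) * b + (d + f) * a + (d + f) * b
                                 ≡ (c * b + d * a + d * b) + (e * b + f * a + f * b)
    c₁-distrib = solve-∀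

  ≡-isSemigroup : ∀ {∙} → Associative ∙ → IsSemigroup ∙
  ≡-isSemigroup assoc = record
    { isMagma = record { isEquivalence = isEquivalence ; ∙-cong = cong₂ _ }
    ; assoc = assoc
    }

  ℤ[φ]-commutativeSemiring : CommutativeSemiring 0ℓ 0ℓ
  ℤ[φ]-commutativeSemiring = record
    { _+_ = _⊕_
    ; _*_ = _⊗_
    ; 0# = [ 0ℤ , 0ℤ ]
    ; 1# = [ 1ℤ , 0ℤ ]
    ; isCommutativeSemiring = isCommutativeSemiringˡ record
      { +-isCommutativeMonoid = isCommutativeMonoidˡ record
        { isSemigroup = ≡-isSemigroup ⊕-assoc ; identityˡ = ⊕-identityˡ ; comm = ⊕-comm }
      ; *-isCommutativeMonoid = isCommutativeMonoidˡ record
        { isSemigroup = ≡-isSemigroup ⊗-assoc ; identityˡ = ⊗-identityˡ ; comm = ⊗-comm }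
      ; distribʳ = ⊗-distribʳ-⊕
      ; zeroˡ = ⊗-zeroˡ
      }
    }

  open CommutativeSemiring ℤ[φ]-commutativeSemiring using (1#; semiring)
  open import Algebra.Properties.Semiring.Exp semiring using (_^_)
  open import Algebra.Properties.Semiring.Mult semiring using (_×_)
  open Congruence ℤ[φ]-commutativeSemiring using (_≡_mod_)

  a+ms≡b+mt⇒m∣a-b : ∀ {m a b s t} → a + m * s ≡ b + m * t → m ∣ a - b
  a+ms≡b+mt⇒m∣a-b {m} {a} {b} {s} {t} a+ms≡b+mt = divides (t - s) (begin
    a - b                   ≡⟨ rearrange a b m s ⟩
    (a + m * s) - b - m * s ≡⟨ cong (λ c → c - b - m * s) a+ms≡b+mt ⟩
    (b + m * t) - b - m * s ≡⟨ factor b m s t ⟩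
    (t - s) * m             ∎)
    where
    open ≡.≡-Reasoning
    rearrange : ∀ a b m s → a - b ≡ (a + m * s) - b - m * s
    rearrange = solve-∀
    factor : ∀ b m s t → (b + m * t) - b - m * s ≡ (t - s) * m
    factor = solve-∀

  φ ψ θ : ℤ[φ]
  φ = [ 0ℤ , 1ℤ ]
  ψ = [ 1ℤ , - 1ℤ ]
  θ = [ - 1ℤ , + 2 ]

  θ⊗θ≡5 : θ ⊗ θ ≡ 5 × 1#
  θ⊗θ≡5 = refl

  2φ≡1+θ : 2 × 1# ⊗ φ ≡ 1# ⊕ θ
  2φ≡1+θ = refl

  φ^n≡[Fₙ₊₁-Fₙ,Fₙ] : ∀ n → φ ^ n ≡ [ + fib (suc n) - + fib n , + fib n ]
  φ^n≡[Fₙ₊₁-Fₙ,Fₙ] zero    = refl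
  φ^n≡[Fₙ₊₁-Fₙ,Fₙ] (suc n) rewrite φ^n≡[Fₙ₊₁-Fₙ,Fₙ] n | pos-+ (fib (suc n)) (fib n) =
    cong₂ [_,_] (c₀-step (+ fib (suc n)) (+ fib n)) (c₁-step (+ fib (suc n)) (+ fib n))
    where
    c₀-step : ∀ a b → 0ℤ * (a - b) + 1ℤ * b ≡ (a + b) - a
    c₀-step = solve-∀
    c₁-step : ∀ a b → 0ℤ * b + 1ℤ * (a - b) + 1ℤ * b ≡ a
    c₁-step = solve-∀

  ψ^n≡[Fₙ₊₁,-Fₙ] : ∀ n → ψ ^ n ≡ [ + fib (suc n) , - + fib n ]
  ψ^n≡[Fₙ₊₁,-Fₙ] zero    = refl
  ψ^n≡[Fₙ₊₁,-Fₙ] (suc n) rewrite ψ^n≡[Fₙ₊₁,-Fₙ] n | pos-+ (fib (suc n)) (fib n) =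
    cong₂ [_,_] (c₀-step (+ fib (suc n)) (+ fib n)) (c₁-step (+ fib (suc n)) (+ fib n))
    where
    c₀-step : ∀ a b → 1ℤ * a + - 1ℤ * - b ≡ a + b
    c₀-step = solve-∀
    c₁-step : ∀ a b → 1ℤ * - b + - 1ℤ * a + - 1ℤ * - b ≡ - a
    c₁-step = solve-∀

  n×1≡[n,0] : ∀ n → n × 1# ≡ [ + n , 0ℤ ]
  n×1≡[n,0] zero    = refl
  n×1≡[n,0] (suc n) rewrite n×1≡[n,0] n = refl

  [m,0]⊗z≡[mz₀,mz₁] : ∀ m z → [ m , 0ℤ ] ⊗ z ≡ [ m * c₀ z , m * c₁ z ]
  [m,0]⊗z≡[mz₀,mz₁] m [ a , b ] = cong₂ [_,_] (c₀-scale m a b) (c₁-scale m a b)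
    where
    c₀-scale : ∀ m a b → m * a + 0ℤ * b ≡ m * a
    c₀-scale = solve-∀
    c₁-scale : ∀ m a b → m * b + 0ℤ * a + 0ℤ * b ≡ m * b
    c₁-scale = solve-∀

  ≡-mod⇒scaled : ∀ {m x y} → x ≡ y mod m × 1# →
                 ∃₂ λ u v → x ⊕ [ + m * c₀ u , + m * c₁ u ] ≡ y ⊕ [ + m * c₀ v , + m * c₁ v ]
  ≡-mod⇒scaled {m} {x} {y} (u , v , x+mu≡y+mv) rewrite n×1≡[n,0] m =
    u , v , ≡.trans (cong (x ⊕_) (≡.sym ([m,0]⊗z≡[mz₀,mz₁] (+ m) u)))
              (≡.trans x+mu≡y+mv (cong (y ⊕_) ([m,0]⊗z≡[mz₀,mz₁] (+ m) v)))

  ≡-mod⇒c₀-∣ : ∀ {m x y} → x ≡ y mod m × 1# → + m ∣ c₀ x - c₀ y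
  ≡-mod⇒c₀-∣ {m} {x} {y} x≡y with ≡-mod⇒scaled {m} {x} {y} x≡y
  ... | u , v , scaled = a+ms≡b+mt⇒m∣a-b {+ m} {c₀ x} {c₀ y} {c₀ u} {c₀ v} (cong c₀ scaled)

  ≡-mod⇒c₁-∣ : ∀ {m x y} → x ≡ y mod m × 1# → + m ∣ c₁ x - c₁ y
  ≡-mod⇒c₁-∣ {m} {x} {y} x≡y with ≡-mod⇒scaled {m} {x} {y} x≡y
  ... | u , v , scaled = a+ms≡b+mt⇒m∣a-b {+ m} {c₁ x} {c₁ y} {c₁ u} {c₁ v} (cong c₁ scaled)

module FibonacciDivisibility where

  open GoldenIntegers
  open CommutativeSemiring ℤ[φ]-commutativeSemiring using (1#; semiring)
  open Congruence ℤ[φ]-commutativeSemiring using (_≡_mod_; φ^[p*p]≡φ-odd; ^[m*p^i]-lift)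
  open import Algebra.Properties.Semiring.Exp semiring using (_^_; ^-assocʳ)
  open import Algebra.Properties.Semiring.Mult semiring using (_×_)
  open import Data.Integer using (+_; -_; _*_; _-_; 0ℤ; 1ℤ)
  open import Data.Integer.Divisibility.Signed
    using (_∣_; ∣ᵤ⇒∣; ∣-reflexive; ∣-trans; ∣m⇒∣-m; ∣n⇒∣m*n; ∣m∣n⇒∣m-n; *-monoʳ-∣)
  open import Data.Integer.Properties using (pos-*)
  open import Data.Integer.Tactic.RingSolver using (solve-∀)
  open import Data.Nat.Divisibility as ℕ∣ using (divides)
  open import Data.Nat.Primality using (prime[2]; prime?)
  open import Relation.Binary.PropositionalEquality as ≡ using (_≡_; _≢_; refl; cong; cong₂)
  open import Relation.Nullary using (yes; no)
  open import Relation.Nullary.Decidable using (from-yes)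

  prime[5] : Prime 5
  prime[5] = from-yes (prime? 5)

  φ^[p*p]≡φ : ∀ {p} → Prime p → p ≢ 5 → φ ^ (p ℕ.* p) ≡ φ mod p × 1#
  φ^[p*p]≡φ {p} prime-p p≢5 with p ℕ.≟ 2
  ... | yes refl = [ 0ℤ , 0ℤ ] , [ 1ℤ , 1ℤ ] , refl  -- φ⁴ = 2 + 3φ = φ + 2 (1 + φ)
  ... | no p≢2 with prime≢2⇒odd prime-p p≢2
  ...   | h , p≡1+2h =
    φ^[p*p]≡φ-odd {q = h} {φ} {θ} prime-p p≡1+2h (p∤ prime[2] p≢2) (p∤ prime[5] p≢5) θ⊗θ≡5 2φ≡1+θ
    where
    p∤ : ∀ {q} → Prime q → p ≢ q → ¬ p ℕ∣.∣ q
    p∤ prime-q p≢q p∣q = p≢q (prime∣prime⇒≡ prime-p prime-q p∣q)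

  φ^5≡ψ^5 : φ ^ 5 ≡ ψ ^ 5 mod 5 × 1#
  φ^5≡ψ^5 = 1# , [ 0ℤ , + 2 ] , refl  -- φ⁵ = 3 + 5φ and ψ⁵ = 8 - 5φ

  5^j∣F[m*5^j] : ∀ j m → + (5 ℕ.^ j) ∣ + fib (m ℕ.* 5 ℕ.^ j)
  5^j∣F[m*5^j] zero    m = ∣ᵤ⇒∣ (ℕ∣.1∣ _)
  5^j∣F[m*5^j] (suc i) m =
    ≡.subst (+ (5 ℕ.^ suc i) ∣_) c₀-difference (∣m⇒∣-m (≡-mod⇒c₀-∣ {x = φ ^ N} {ψ ^ N} φ^N≡ψ^N))
    where
    N : ℕ
    N = m ℕ.* 5 ℕ.^ suc i
    power : ∀ z → (z ^ 5) ^ (m ℕ.* 5 ℕ.^ i) ≡ z ^ N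
    power z = ≡.trans (^-assocʳ z 5 (m ℕ.* 5 ℕ.^ i)) (cong (z ^_) (swap 5 m (5 ℕ.^ i)))
      where
      open import Data.Nat.Tactic.RingSolver using () renaming (solve-∀ to ℕ-solve-∀)
      swap : ∀ a b c → a ℕ.* (b ℕ.* c) ≡ b ℕ.* (a ℕ.* c)
      swap = ℕ-solve-∀
    φ^N≡ψ^N : φ ^ N ≡ ψ ^ N mod (5 ℕ.^ suc i) × 1#
    φ^N≡ψ^N = ≡.subst₂ (λ a b → a ≡ b mod (5 ℕ.^ suc i) × 1#) (power φ) (power ψ)
                (^[m*p^i]-lift prime[5] m i φ^5≡ψ^5)
    c₀-difference : - (c₀ (φ ^ N) - c₀ (ψ ^ N)) ≡ + fib N
    c₀-difference rewrite φ^n≡[Fₙ₊₁-Fₙ,Fₙ] N | ψ^n≡[Fₙ₊₁,-Fₙ] N = cancel (+ fib (suc N)) (+ fib N)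
      where
      cancel : ∀ a b → - ((a - b) - a) ≡ b
      cancel = solve-∀

  p^[1+2k]∣F[n*p^[2k+2]]-F[n*p^[2k]] : ∀ {p} → Prime p → p ≢ 5 → ∀ n k →
    + (p ℕ.^ suc (2 ℕ.* k)) ∣ + fib (n ℕ.* p ℕ.^ (2 ℕ.* suc k)) - + fib (n ℕ.* p ℕ.^ (2 ℕ.* k))
  p^[1+2k]∣F[n*p^[2k+2]]-F[n*p^[2k]] {p} prime-p p≢5 n k =
    ≡.subst (+ (p ℕ.^ suc (2 ℕ.* k)) ∣_) (cong₂ _-_ (c₁-φ^ N) (c₁-φ^ M))
      (≡-mod⇒c₁-∣ {x = φ ^ N} {φ ^ M} φ^N≡φ^M)
    where
    N M : ℕ
    N = n ℕ.* p ℕ.^ (2 ℕ.* suc k)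
    M = n ℕ.* p ℕ.^ (2 ℕ.* k)
    c₁-φ^ : ∀ n → c₁ (φ ^ n) ≡ + fib n
    c₁-φ^ n = cong c₁ (φ^n≡[Fₙ₊₁-Fₙ,Fₙ] n)
    exponent : p ℕ.* p ℕ.* M ≡ N
    exponent = ≡.trans (regroup p n (p ℕ.^ (2 ℕ.* k))) (cong (λ e → n ℕ.* p ℕ.^ e) (≡.sym (ℕ.*-suc 2 k)))
      where
      open import Data.Nat.Tactic.RingSolver using () renaming (solve-∀ to ℕ-solve-∀)
      regroup : ∀ p n c → p ℕ.* p ℕ.* (n ℕ.* c) ≡ n ℕ.* (p ℕ.* (p ℕ.* c))
      regroup = ℕ-solve-∀
    φ^N≡φ^M : φ ^ N ≡ φ ^ M mod (p ℕ.^ suc (2 ℕ.* k)) × 1#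
    φ^N≡φ^M = ≡.subst (λ a → a ≡ φ ^ M mod (p ℕ.^ suc (2 ℕ.* k)) × 1#)
                (≡.trans (^-assocʳ φ (p ℕ.* p) M) (cong (φ ^_) exponent))
                (^[m*p^i]-lift prime-p n (2 ℕ.* k) (φ^[p*p]≡φ prime-p p≢5))

  ^-monoʳ-∣ : ∀ p {m n} → m ℕ.≤ n → + (p ℕ.^ m) ∣ + (p ℕ.^ n)
  ^-monoʳ-∣ p {m} m≤n with ℕ.m≤n⇒∃[o]m+o≡n m≤n
  ... | o , refl =
    ∣ᵤ⇒∣ (divides (p ℕ.^ o) (≡.trans (ℕ.^-distribˡ-+-* p m o) (ℕ.*-comm (p ℕ.^ m) (p ℕ.^ o))))

  5[a-b]≡5a-5b : ∀ a b → + 5 * (+ a - + b) ≡ + (5 ℕ.* a) - + (5 ℕ.* b)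
  5[a-b]≡5a-5b a b = ≡.trans (distrib (+ a) (+ b)) (cong₂ _-_ (≡.sym (pos-* 5 a)) (≡.sym (pos-* 5 b)))
    where
    distrib : ∀ a b → + 5 * (a - b) ≡ + 5 * a - + 5 * b
    distrib = solve-∀

  p^[k+1]∣5F[n*p^[2k+2]]-5F[n*p^[2k]] : ∀ {p} → Prime p → p ≢ 5 → ∀ n k →
    + (p ℕ.^ suc k) ∣ + (5 ℕ.* fib (n ℕ.* p ℕ.^ (2 ℕ.* suc k))) - + (5 ℕ.* fib (n ℕ.* p ℕ.^ (2 ℕ.* k)))
  p^[k+1]∣5F[n*p^[2k+2]]-5F[n*p^[2k]] {p} prime-p p≢5 n k =
    ≡.subst (+ (p ℕ.^ suc k) ∣_) (5[a-b]≡5a-5b (fib N) (fib M))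
      (∣n⇒∣m*n (+ 5) (∣-trans (^-monoʳ-∣ p (ℕ.s≤s (ℕ.m≤m+n k _)))
                              (p^[1+2k]∣F[n*p^[2k+2]]-F[n*p^[2k]] prime-p p≢5 n k)))
    where
    N M : ℕ
    N = n ℕ.* p ℕ.^ (2 ℕ.* suc k)
    M = n ℕ.* p ℕ.^ (2 ℕ.* k)

  5^[k+1]∣5F[n*5^[2k+2]]-5F[n*5^[2k]] : ∀ n k →
    + (5 ℕ.^ suc k) ∣ + (5 ℕ.* fib (n ℕ.* 5 ℕ.^ (2 ℕ.* suc k))) - + (5 ℕ.* fib (n ℕ.* 5 ℕ.^ (2 ℕ.* k)))
  5^[k+1]∣5F[n*5^[2k+2]]-5F[n*5^[2k]] n k =
    ≡.subst (+ (5 ℕ.^ suc k) ∣_) (5[a-b]≡5a-5b (fib N) (fib M))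
      (∣-trans (∣-reflexive (pos-* 5 (5 ℕ.^ k)))
        (*-monoʳ-∣ (+ 5) (∣m∣n⇒∣m-n (weaken (5^j∣F[m*5^j] (2 ℕ.* suc k) n) k≤2[k+1])
                                      (weaken (5^j∣F[m*5^j] (2 ℕ.* k) n) (ℕ.m≤m+n k _)))))
    where
    N M : ℕ
    N = n ℕ.* 5 ℕ.^ (2 ℕ.* suc k)
    M = n ℕ.* 5 ℕ.^ (2 ℕ.* k)
    weaken : ∀ {j x} → + (5 ℕ.^ j) ∣ x → k ℕ.≤ j → + (5 ℕ.^ k) ∣ x
    weaken 5^j∣x k≤j = ∣-trans (^-monoʳ-∣ 5 k≤j) 5^j∣x
    k≤2[k+1] : k ℕ.≤ 2 ℕ.* suc k
    k≤2[k+1] = ℕ.≤-trans (ℕ.n≤1+n k) (ℕ.m≤m+n (suc k) _)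

open FibonacciDivisibility
  using (p^[k+1]∣5F[n*p^[2k+2]]-5F[n*p^[2k]]; 5^[k+1]∣5F[n*5^[2k+2]]-5F[n*5^[2k]])

open import Data.Nat using (_*_; _^_; _≟_)
open import Data.Integer using (ℤ; +_; _-_)
open import Data.Integer.Divisibility using (_∣_)
open import Data.Integer.Divisibility.Signed using (∣⇒∣ᵤ)
open import Relation.Binary.PropositionalEquality using (refl)
open import Relation.Nullary using (yes; no)

lemma3p2 : (p n k : ℕ) → Prime p →
    (+ (p ^ suc k)) ∣ ((+ (5 * fib (n * p ^ (2 * suc k)))) - (+ (5 * fib (n * p ^ (2 * k)))))
lemma3p2 p n k prime-p with p ≟ 5
... | yes refl = ∣⇒∣ᵤ (5^[k+1]∣5F[n*5^[2k+2]]-5F[n*5^[2k]] n k)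
... | no p≢5   = ∣⇒∣ᵤ (p^[k+1]∣5F[n*p^[2k+2]]-5F[n*p^[2k]] prime-p p≢5 n k)
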